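{- Let $n\ge 13$, let $Q$ be a query graph on an $n$-element vertex set $V$ with minimum degree at least $n-3$, and suppose the answers $q(x,y)$ to all pairs $xy\in E(Q)$ have been received for some hidden tree on $V$. If some consistent tree $T_0$ has diameter at least $4$, then there is a pair of vertices and an integer $j\ge 4$ such that the distance of this pair is $j$ in every consistent tree.
   Context: The answer $q(x,y)$ to a queried pair is the distance of $x$ and $y$ in the hidden tree. A tree on $V$ is consistent if for every edge $xy$ of $Q$ its distance between $x$ and $y$ equals $q(x,y)$. -}

module Defs where

open import Data.Nat using (ℕ; zero; suc; _≤_; _∸_; _+_)
open import Data.Fin using (Fin)
open import Data.Bool using (Bool; true; false; T)
open import Data.List using (List; []; _∷_; length; filterᵇ; allFin; head; last)
open import Data.List.Relation.Unary.Unique.Propositional using (Unique)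
open import Data.Product using (Σ; _×_; ∃; ∃-syntax)
open import Relation.Binary.PropositionalEquality using (_≡_)
open import Relation.Nullary using (¬_)
open import Data.Unit using (⊤)
open import Data.Empty using (⊥)

record SimpleGraph (n : ℕ) : Set where
  field
    adj   : Fin n → Fin n → Bool
    sym   : ∀ x y → adj x y ≡ adj y x
    irefl : ∀ x → adj x x ≡ false

open SimpleGraph public

Adj : ∀ {n} → SimpleGraph n → Fin n → Fin n → Set
Adj G x y = T (adj G x y)

degree : ∀ {n} → SimpleGraph n → Fin n → ℕ
degree {n} G x = length (filterᵇ (adj G x) (allFin n))

data Walk {n} (G : SimpleGraph n) : Fin n → Fin n → ℕ → Set where
  here : ∀ {x} → Walk G x x 0
  step : ∀ {x y z k} → Adj G x y → Walk G y z k → Walk G x z (suc k)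

Dist : ∀ {n} → SimpleGraph n → Fin n → Fin n → ℕ → Set
Dist G x y k = Walk G x y k × (∀ m → Walk G x y m → k ≤ m)

Connected : ∀ {n} → SimpleGraph n → Set
Connected G = ∀ x y → ∃[ k ] Walk G x y k

Chain : ∀ {n} → SimpleGraph n → List (Fin n) → Set
Chain G []           = ⊤
Chain G (x ∷ [])     = ⊤
Chain G (x ∷ y ∷ vs) = Adj G x y × Chain G (y ∷ vs)

lastOf : ∀ {A : Set} → A → List A → A
lastOf x []       = x
lastOf x (y ∷ ys) = lastOf y ys

IsCycle : ∀ {n} → SimpleGraph n → List (Fin n) → Set
IsCycle G []               = ⊥
IsCycle G (x ∷ [])         = ⊥
IsCycle G (x ∷ y ∷ [])     = ⊥
IsCycle G (x ∷ y ∷ z ∷ vs) =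
  Unique (x ∷ y ∷ z ∷ vs) × Chain G (x ∷ y ∷ z ∷ vs) × Adj G (lastOf z vs) x

Acyclic : ∀ {n} → SimpleGraph n → Set
Acyclic G = ∀ vs → ¬ IsCycle G vs

IsTree : ∀ {n} → SimpleGraph n → Set
IsTree G = Connected G × Acyclic G

-- T is consistent with the answers of the hidden tree H on the queries Q:
-- for every edge xy of Q, the distance of x,y in T equals q(x,y), the
-- distance of x,y in H
Consistent : ∀ {n} → SimpleGraph n → SimpleGraph n → SimpleGraph n → Set
Consistent Q H T = ∀ x y k → Adj Q x y → Dist H x y k → Dist T x y k

DiamAtLeast : ∀ {n} → SimpleGraph n → ℕ → Set
DiamAtLeast G d = ∃[ x ] ∃[ y ] ∃[ k ] (Dist G x y k × d ≤ k)

{-# OPTIONS --safe #-}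
module Submission where

-- If some queried pair lies at distance at least 4 in T₀, its answer fixes that distance in every
-- consistent tree. Otherwise all answers are at most 3, and for a path a b c d e of length 4 in T₀
-- we show d_T(a,e) = 4 in every consistent tree T. By the degree bound each vertex misses at most
-- two others in Q, and as n ≥ 13 any four vertices have a common Q-neighbour; queried pairs have
-- the same distance in T as in T₀. The key step is that a and e have no common T-neighbour x:
-- a common Q-neighbour w of a, b, e, x would have a T-geodesic to x that is incompatible with
-- its T₀-distances to a, b, e being at most 3. A path from a to e of length 4 without
-- backtracking is then assembled in T from the answers for a c and c e, or for a b and b e, and
-- in a tree such a path is a geodesic.

open import Defs hiding (sym)
open import Data.Nat using (ℕ; zero; suc; _≤_; _<_; _∸_; _+_; _*_; z≤n; s≤s)
open import Data.Nat.Properties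
  using (≤-refl; ≤-trans; ≤-antisym; ≤-pred; n≤1+n; 1+n≰n; ≮⇒≥; <⇒≱; <⇒≤; _<?_;
         *-suc; +-comm; +-suc; +-mono-≤; +-monoʳ-≤;
         +-cancelˡ-≤; m≤n+m∸n; m≤n⇒m<n∨m≡n; m<1+n⇒m<n∨m≡n; module ≤-Reasoning)
open import Data.Fin using (Fin)
open import Data.Fin.Properties using (_≟_; any?)
open import Data.Bool using (T)
open import Data.Bool.Properties using (T?)
open import Data.List using (List; []; _∷_; _++_; [_]; length; filter; concatMap; allFin)
open import Data.List.Properties using (length-++; length-++-sucʳ; length-tabulate)
open import Data.List.Membership.Propositional using (_∈_)
open import Data.List.Membership.Propositional.Properties
  using (∈-∃++; ∈-++⁻; ∈-++⁺ˡ; ∈-++⁺ʳ; ∈-filter⁺; ∈-allFin; ∈-concat⁺)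
open import Data.List.Relation.Binary.Subset.Propositional using (_⊆_)
open import Data.List.Relation.Unary.All as All using (All; []; _∷_; all?)
import Data.List.Relation.Unary.All.Properties as Allₚ
open import Data.List.Relation.Unary.Any as Any using (here; there)
import Data.List.Relation.Unary.Any.Properties as Anyₚ
open import Data.List.Relation.Unary.AllPairs using ([]; _∷_)
import Data.List.Relation.Unary.AllPairs.Properties as AllPairs
open import Data.List.Relation.Unary.Unique.Propositional using (Unique)
open import Data.List.Relation.Unary.Unique.Propositional.Properties using (allFin⁺)
open import Data.Product using (∃-syntax; _×_; _,_; proj₁; proj₂)
open import Data.Sum using (_⊎_; inj₁; inj₂)
open import Data.Empty using (⊥; ⊥-elim)
open import Data.Unit using (tt)
open import Function using (_∘_; id)
open import Relation.Nullary using (¬_; Dec; yes; no; contradiction)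
open import Relation.Nullary.Decidable using (_×-dec_)
import Relation.Nullary.Decidable as Dec
open import Relation.Unary using (Pred; Decidable)
open import Relation.Unary.Properties using (∁?)
open import Relation.Binary.PropositionalEquality
  using (_≡_; _≢_; refl; sym; trans; cong; subst; ≢-sym)

length-filter+length-filter-∁ : ∀ {a p} {A : Set a} {P : Pred A p} (P? : Decidable P) xs →
  length (filter P? xs) + length (filter (∁? P?) xs) ≡ length xs
length-filter+length-filter-∁ P? [] = refl
length-filter+length-filter-∁ P? (x ∷ xs) with P? x
... | yes _ = cong suc (length-filter+length-filter-∁ P? xs)
... | no _  = trans (+-suc _ _) (cong suc (length-filter+length-filter-∁ P? xs))

unique-⊆⇒length-≤ : ∀ {a} {A : Set a} {xs ys : List A} → Unique xs → xs ⊆ ys → length xs ≤ length ys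
unique-⊆⇒length-≤ [] _ = z≤n
unique-⊆⇒length-≤ {xs = x ∷ xs} (x∉xs ∷ !xs) x∷xs⊆ys with ∈-∃++ (x∷xs⊆ys (here refl))
... | us , vs , refl = begin
  suc (length xs)          ≤⟨ s≤s (unique-⊆⇒length-≤ !xs xs⊆us++vs) ⟩
  suc (length (us ++ vs))  ≡⟨ length-++-sucʳ us x vs ⟨
  length (us ++ x ∷ vs)    ∎
  where
  open ≤-Reasoning
  xs⊆us++vs : xs ⊆ us ++ vs
  xs⊆us++vs y∈xs with ∈-++⁻ us (x∷xs⊆ys (there y∈xs))
  ... | inj₁ y∈us         = ∈-++⁺ˡ y∈us
  ... | inj₂ (here refl)  = contradiction refl (All.lookup x∉xs y∈xs)
  ... | inj₂ (there y∈vs) = ∈-++⁺ʳ us y∈vs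

length-concatMap-≤ : ∀ {a b} {A : Set a} {B : Set b} {f : A → List B} {c} →
  (∀ x → length (f x) ≤ c) → ∀ xs → length (concatMap f xs) ≤ c * length xs
length-concatMap-≤ bound [] = z≤n
length-concatMap-≤ {f = f} {c} bound (x ∷ xs) = begin
  length (f x ++ concatMap f xs)           ≡⟨ length-++ (f x) ⟩
  length (f x) + length (concatMap f xs)   ≤⟨ +-mono-≤ (bound x) (length-concatMap-≤ bound xs) ⟩
  c + c * length xs                        ≡⟨ *-suc c (length xs) ⟨
  c * suc (length xs)                      ∎
  where open ≤-Reasoning

module _ {p} {P : ℕ → Set p} (P? : Decidable P) where

  least-or-none : ∀ k → (∃[ m ] (P m × ∀ j → P j → m ≤ j)) ⊎ (∀ j → j < k → ¬ P j)
  least-or-none zero = inj₂ λ _ ()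
  least-or-none (suc k) with least-or-none k
  ... | inj₁ found = inj₁ found
  ... | inj₂ none with P? k
  ...   | yes Pk = inj₁ (k , Pk , λ j Pj → ≮⇒≥ λ j<k → none j j<k Pj)
  ...   | no ¬Pk = inj₂ none′
    where
    none′ : ∀ j → j < suc k → ¬ P j
    none′ j j<1+k Pj with m<1+n⇒m<n∨m≡n j<1+k
    ... | inj₁ j<k  = none j j<k Pj
    ... | inj₂ refl = ¬Pk Pj

  least : ∀ {k} → P k → ∃[ m ] (P m × ∀ j → P j → m ≤ j)
  least {k} Pk with least-or-none (suc k)
  ... | inj₁ found = found
  ... | inj₂ none  = contradiction Pk (none k ≤-refl)

lastOf-∷ʳ : ∀ {A : Set} (x : A) ys z → lastOf x (ys ++ [ z ]) ≡ z
lastOf-∷ʳ x []       z = refl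
lastOf-∷ʳ x (y ∷ ys) z = lastOf-∷ʳ y ys z

unique-∷ʳ : ∀ {a} {A : Set a} {xs : List A} {y} → Unique xs → All (_≢ y) xs → Unique (xs ++ [ y ])
unique-∷ʳ !xs xs≢y = AllPairs.++⁺ !xs ([] ∷ []) (All.map (_∷ []) xs≢y)

module Walks {n} (G : SimpleGraph n) where

  Adj? : ∀ x y → Dec (Adj G x y)
  Adj? x y = T? (adj G x y)

  adj-sym : ∀ {x y} → Adj G x y → Adj G y x
  adj-sym {x} {y} = subst T (SimpleGraph.sym G x y)

  adj⇒≢ : ∀ {x y} → Adj G x y → x ≢ y
  adj⇒≢ {x} xx refl = subst T (irefl G x) xx

  chain-∷ʳ : ∀ {x y} xs → Chain G (x ∷ xs) → Adj G (lastOf x xs) y → Chain G (x ∷ xs ++ [ y ])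
  chain-∷ʳ []       _            last-y = last-y , tt
  chain-∷ʳ (v ∷ vs) (edge , path) last-y = edge , chain-∷ʳ vs path last-y

  _∷ʳʷ_ : ∀ {x y z k} → Walk G x y k → Adj G y z → Walk G x z (suc k)
  here      ∷ʳʷ yz = step yz here
  step xy w ∷ʳʷ yz = step xy (w ∷ʳʷ yz)

  reverseʷ : ∀ {x y k} → Walk G x y k → Walk G y x k
  reverseʷ here        = here
  reverseʷ (step xy w) = reverseʷ w ∷ʳʷ adj-sym xy

  unsnocʷ : ∀ {x z k} → Walk G x z (suc k) → ∃[ y ] (Walk G x y k × Adj G y z)
  unsnocʷ (step xz here) = _ , here , xz
  unsnocʷ (step xy (step yy′ w)) with y , w′ , yz ← unsnocʷ (step yy′ w) = y , step xy w′ , yz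

  walk-zero⇒≡ : ∀ {x y} → Walk G x y 0 → x ≡ y
  walk-zero⇒≡ here = refl

  walk? : ∀ k x y → Dec (Walk G x y k)
  walk? zero    x y = Dec.map′ (λ { refl → here }) walk-zero⇒≡ (x ≟ y)
  walk? (suc k) x y = Dec.map′ (λ (z , xz , w) → step xz w) (λ { (step xz w) → _ , xz , w })
                               (any? λ z → Adj? x z ×-dec walk? k z y)

  walk⇒dist : ∀ {x y k} → Walk G x y k → ∃[ m ] Dist G x y m
  walk⇒dist {x} {y} = least (λ k → walk? k x y)

  dist-exists : Connected G → ∀ x y → ∃[ k ] Dist G x y k
  dist-exists connected x y = walk⇒dist (proj₂ (connected x y))

  dist-refl : ∀ {x} → Dist G x x 0
  dist-refl = here , λ _ _ → z≤n

  dist-suc⇒≢ : ∀ {x y k} → Dist G x y (suc k) → x ≢ y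
  dist-suc⇒≢ (_ , shortest) refl with () ← shortest 0 here

  dist-adj : ∀ {x y} → Adj G x y → Dist G x y 1
  dist-adj xy = step xy here , shortest
    where
    shortest : ∀ m → Walk G _ _ m → 1 ≤ m
    shortest zero    w = contradiction (walk-zero⇒≡ w) (adj⇒≢ xy)
    shortest (suc m) w = s≤s z≤n

  dist-one⇒adj : ∀ {x y} → Dist G x y 1 → Adj G x y
  dist-one⇒adj (step xy here , _) = xy

  dist-zero⇒≡ : ∀ {x y} → Dist G x y 0 → x ≡ y
  dist-zero⇒≡ (w , _) = walk-zero⇒≡ w

  dist-unique : ∀ {x y k m} → Dist G x y k → Dist G x y m → k ≡ m
  dist-unique (w , shortest) (w′ , shortest′) = ≤-antisym (shortest _ w′) (shortest′ _ w)

  dist-sym : ∀ {x y k} → Dist G x y k → Dist G y x k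
  dist-sym (w , shortest) = reverseʷ w , λ m v → shortest m (reverseʷ v)

  dist-pred : ∀ {x z k} → Dist G x z (suc k) → ∃[ y ] (Dist G x y k × Adj G y z)
  dist-pred (w , shortest) with y , w′ , yz ← unsnocʷ w =
    y , (w′ , λ m v → ≤-pred (shortest (suc m) (v ∷ʳʷ yz))) , yz

  dist-adj-≤ : ∀ {u v z k m} → Dist G u v k → Dist G u z m → Adj G v z → k ≤ suc m
  dist-adj-≤ (_ , shortest) (w , _) vz = shortest _ (w ∷ʳʷ adj-sym vz)

  record Path₄ (a b c d e : Fin n) : Set where
    field
      ab  : Adj G a b
      bc  : Adj G b c
      cd  : Adj G c d
      de  : Adj G d e
      a≢c : a ≢ c
      b≢d : b ≢ d
      c≢e : c ≢ e

  reverse-path₄ : ∀ {a b c d e} → Path₄ a b c d e → Path₄ e d c b a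
  reverse-path₄ P = record
    { ab = adj-sym de ; bc = adj-sym cd ; cd = adj-sym bc ; de = adj-sym ab
    ; a≢c = ≢-sym c≢e ; b≢d = ≢-sym b≢d ; c≢e = ≢-sym a≢c }
    where open Path₄ P

  geodesic⇒path₄ : ∀ {a z k} → Dist G a z (4 + k) → ∃[ b ] ∃[ c ] ∃[ d ] ∃[ e ] Path₄ a b c d e
  geodesic⇒path₄ {k = k} (step ab (step bc (step cd (step de rest))) , shortest) =
    _ , _ , _ , _ , record
      { ab = ab ; bc = bc ; cd = cd ; de = de
      ; a≢c = λ { refl → no-shortcut (step cd (step de rest)) }
      ; b≢d = λ { refl → no-shortcut (step ab (step de rest)) }
      ; c≢e = λ { refl → no-shortcut (step ab (step bc rest)) } }
    where
    no-shortcut : Walk G _ _ (2 + k) → ⊥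
    no-shortcut w = <⇒≱ (s≤s (s≤s (s≤s (n≤1+n k)))) (shortest _ w)

module Tree {n} {G : SimpleGraph n} (tree : IsTree G) where
  open Walks G public

  dist : ∀ x y → ∃[ k ] Dist G x y k
  dist = dist-exists (proj₁ tree)

  no-closing-edge : ∀ x y ms z → Unique (x ∷ y ∷ ms ++ [ z ]) → Chain G (x ∷ y ∷ ms ++ [ z ]) →
                    ¬ Adj G z x
  no-closing-edge x y []       z distinct path zx = proj₂ tree _ (distinct , path , zx)
  no-closing-edge x y (m ∷ ms) z distinct path zx =
    proj₂ tree _ (distinct , path , subst (λ v → Adj G v x) (sym (lastOf-∷ʳ m ms z)) zx)

  FartherThan : Fin n → ℕ → Fin n → Set
  FartherThan u k w = ∀ m → Walk G u w m → k < m

  farther⇒≢ : ∀ {u k w v} → FartherThan u k w → Dist G u v k → v ≢ w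
  farther⇒≢ far (w , _) refl = 1+n≰n (far _ w)

  farther-path : ∀ {u k p z ms} → Dist G u p (suc k) → Dist G u z (suc k) →
                 All (FartherThan u (suc k)) ms → All (FartherThan u k) (p ∷ ms ++ [ z ])
  farther-path Dp Dz beyond =
    proj₂ Dp ∷ Allₚ.++⁺ (All.map (λ far m w → <⇒≤ (far m w)) beyond) (proj₂ Dz ∷ [])

  -- Stepping both ends back towards u keeps the path simple, until the ends meet and close a cycle.
  no-path-beyond : ∀ k {u p z} ms → Dist G u p k → Dist G u z k → p ≢ z →
                   Unique (p ∷ ms ++ [ z ]) → Chain G (p ∷ ms ++ [ z ]) →
                   All (FartherThan u k) ms → ⊥
  no-path-beyond zero    ms Dp Dz p≢z _ _ _ = p≢z (trans (sym (dist-zero⇒≡ Dp)) (dist-zero⇒≡ Dz))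
  no-path-beyond (suc k) {u} {p} {z} ms Dp Dz p≢z distinct path beyond
    with p′ , Dp′ , p′p ← dist-pred Dp | z′ , Dz′ , z′z ← dist-pred Dz | p′ ≟ z′
       | farther-path Dp Dz beyond
  ... | yes refl | far =
    no-closing-edge p′ p ms z (All.map (λ f → farther⇒≢ f Dp′) far ∷ distinct) (p′p , path)
      (adj-sym z′z)
  ... | no p′≢z′ | far = no-path-beyond k (p ∷ ms ++ [ z ]) Dp′ Dz′ p′≢z′ distinct′ path′ far
    where
    distinct′ : Unique (p′ ∷ (p ∷ ms ++ [ z ]) ++ [ z′ ])
    distinct′ = Allₚ.++⁺ (All.map (λ f → farther⇒≢ f Dp′) far) (p′≢z′ ∷ [])
              ∷ unique-∷ʳ distinct (All.map (λ f → ≢-sym (farther⇒≢ f Dz′)) far)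
    path′ : Chain G (p′ ∷ (p ∷ ms ++ [ z ]) ++ [ z′ ])
    path′ = p′p , chain-∷ʳ (ms ++ [ z ]) path
                    (subst (λ v → Adj G v z′) (sym (lastOf-∷ʳ p ms z)) (adj-sym z′z))

  adjacent⇒not-equidistant : ∀ {u v z k} → Dist G u v k → Dist G u z k → ¬ Adj G v z
  adjacent⇒not-equidistant {k = k} Dv Dz vz =
    no-path-beyond k [] Dv Dz (adj⇒≢ vz) ((adj⇒≢ vz ∷ []) ∷ [] ∷ []) (vz , tt) []

  unique-parent : ∀ {u p v z k} → Dist G u p k → Dist G u v (suc k) → Dist G u z k →
                  Adj G p v → Adj G v z → p ≡ z
  unique-parent {p = p} {z = z} {k} Dp Dv Dz pv vz with p ≟ z
  ... | yes p≡z = p≡z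
  ... | no p≢z  =
    ⊥-elim (no-path-beyond k (_ ∷ []) Dp Dz p≢z distinct (pv , vz , tt) (proj₂ Dv ∷ []))
    where
    distinct = (adj⇒≢ pv ∷ p≢z ∷ []) ∷ (adj⇒≢ vz ∷ []) ∷ [] ∷ []

  extend : ∀ {u p v z k} → Dist G u p k → Dist G u v (suc k) → Adj G p v → Adj G v z → z ≢ p →
           Dist G u z (2 + k)
  -- d(u,z) lies between k and 2 + k; the two smaller values are excluded by acyclicity.
  extend {u} {p} {v} {z} {k} Dp Dv pv vz z≢p with dist u z
  ... | m , Dz with m≤n⇒m<n∨m≡n (dist-adj-≤ Dz Dv (adj-sym vz))
  ... | inj₂ refl = Dz
  ... | inj₁ (s≤s m≤1+k) with m≤n⇒m<n∨m≡n m≤1+k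
  ...   | inj₂ refl = ⊥-elim (adjacent⇒not-equidistant Dv Dz vz)
  ...   | inj₁ (s≤s m≤k) with ≤-antisym m≤k (≤-pred (dist-adj-≤ Dv Dz vz))
  ...     | refl = ⊥-elim (z≢p (sym (unique-parent Dp Dv Dz pv vz)))

  extend-path₄ : ∀ {u a b c d e s} → Dist G u a s → Dist G u b (suc s) → Path₄ a b c d e →
                 Dist G u e (4 + s)
  extend-path₄ Da Db P = extend Dc Dd cd de (≢-sym c≢e)
    where
    open Path₄ P
    Dc = extend Da Db ab bc (≢-sym a≢c)
    Dd = extend Db Dc bc cd (≢-sym b≢d)

  module _ {a b c d e} (P : Path₄ a b c d e) where
    open Path₄ P

    path₄-dist₂ : Dist G a c 2
    path₄-dist₂ = extend dist-refl (dist-adj ab) ab bc (≢-sym a≢c)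

    path₄-dist₃ : Dist G a d 3
    path₄-dist₃ = extend (dist-adj ab) path₄-dist₂ bc cd (≢-sym b≢d)

    path₄-dist : Dist G a e 4
    path₄-dist = extend-path₄ dist-refl (dist-adj ab) P

AgreeOn : ∀ {n} → SimpleGraph n → SimpleGraph n → SimpleGraph n → Set
AgreeOn Q T T′ = ∀ {u v k} → Adj Q u v → Dist T u v k → Dist T′ u v k

consistent⇒agree : ∀ {n} (Q : SimpleGraph n) {H T T′ : SimpleGraph n} → Connected H →
                   Consistent Q H T → Consistent Q H T′ → AgreeOn Q T T′
consistent⇒agree Q {H} {T} {T′} connected consistent consistent′ {u} {v} uv Duv
  with j , Dj ← Walks.dist-exists H connected u v =
  subst (Dist T′ u v) (Walks.dist-unique T (consistent u v j uv Dj) Duv) (consistent′ u v j uv Dj)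

module _ {n} (Q : SimpleGraph n) {T : SimpleGraph n} (connected : Connected T) where
  open Walks T using (dist-exists; dist-unique)

  long-query-or-all-short : ∀ ℓ →
    (∃[ u ] ∃[ v ] ∃[ k ] (Adj Q u v × Dist T u v k × ℓ < k)) ⊎
    (∀ {u v k} → Adj Q u v → Dist T u v k → k ≤ ℓ)
  long-query-or-all-short ℓ
    with any? (λ u → any? (λ v → Walks.Adj? Q u v ×-dec ℓ <? proj₁ (dist-exists connected u v)))
  ... | yes (u , v , uv , ℓ<k) = inj₁ (u , v , _ , uv , proj₂ (dist-exists connected u v) , ℓ<k)
  ... | no none = inj₂ λ {u} {v} uv Duv → ≮⇒≥ λ ℓ<k →
    none (u , v , uv , subst (ℓ <_) (dist-unique Duv (proj₂ (dist-exists connected u v))) ℓ<k)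

module MinDegree {n} (Q : SimpleGraph n) (deg : ∀ x → n ∸ 3 ≤ degree Q x) where
  open Walks Q

  -- u is a non-neighbour of itself, so the bound 3 leaves room for only two others.
  non-neighbours : Fin n → List (Fin n)
  non-neighbours u = filter (∁? (Adj? u)) (allFin n)

  ∈-non-neighbours : ∀ {u v} → ¬ Adj Q u v → v ∈ non-neighbours u
  ∈-non-neighbours {u} {v} = ∈-filter⁺ (∁? (Adj? u)) (∈-allFin v)

  length-non-neighbours : ∀ u → length (non-neighbours u) ≤ 3
  length-non-neighbours u = +-cancelˡ-≤ (degree Q u) _ _ (begin
    degree Q u + length (non-neighbours u)  ≡⟨ length-filter+length-filter-∁ (Adj? u) (allFin n) ⟩
    length (allFin n)                       ≡⟨ length-tabulate id ⟩
    n                                       ≤⟨ m≤n+m∸n n 3 ⟩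
    3 + (n ∸ 3)                             ≤⟨ +-monoʳ-≤ 3 (deg u) ⟩
    3 + degree Q u                          ≡⟨ +-comm 3 (degree Q u) ⟩
    degree Q u + 3                          ∎)
    where open ≤-Reasoning

  common-neighbour : ∀ vs → 3 * length vs < n → ∃[ w ] All (Adj Q w) vs
  common-neighbour vs small with any? (λ w → all? (Adj? w) vs)
  ... | yes found = found
  ... | no none   = contradiction (begin
    n                                  ≡⟨ length-tabulate id ⟨
    length (allFin n)                  ≤⟨ unique-⊆⇒length-≤ (allFin⁺ n) covered ⟩
    length (concatMap non-neighbours vs) ≤⟨ length-concatMap-≤ length-non-neighbours vs ⟩
    3 * length vs                      ∎) (<⇒≱ small)
    where
    open ≤-Reasoning
    covered : allFin n ⊆ concatMap non-neighbours vs
    covered {w} _ = ∈-concat⁺ (Anyₚ.map⁺ (Any.map (λ ¬wv → ∈-non-neighbours (¬wv ∘ adj-sym))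
                                                  (Allₚ.¬All⇒Any¬ (Adj? w) vs (none ∘ (w ,_)))))

  adjacent-unless-two : ∀ {u y₁ y₂ y} → ¬ Adj Q u y₁ → ¬ Adj Q u y₂ →
    u ≢ y₁ → u ≢ y₂ → y₁ ≢ y₂ → u ≢ y → y₁ ≢ y → y₂ ≢ y → Adj Q u y
  adjacent-unless-two {u} {y₁} {y₂} {y} ¬uy₁ ¬uy₂ u≢y₁ u≢y₂ y₁≢y₂ u≢y y₁≢y y₂≢y with Adj? u y
  ... | yes uy = uy
  ... | no ¬uy = contradiction
    (≤-trans (unique-⊆⇒length-≤ distinct non-adjacent) (length-non-neighbours u)) 1+n≰n
    where
    distinct : Unique (u ∷ y₁ ∷ y₂ ∷ y ∷ [])
    distinct = (u≢y₁ ∷ u≢y₂ ∷ u≢y ∷ []) ∷ (y₁≢y₂ ∷ y₁≢y ∷ []) ∷ (y₂≢y ∷ []) ∷ [] ∷ []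
    non-adjacent : (u ∷ y₁ ∷ y₂ ∷ y ∷ []) ⊆ non-neighbours u
    non-adjacent (here refl)                         = ∈-non-neighbours (λ uu → adj⇒≢ uu refl)
    non-adjacent (there (here refl))                 = ∈-non-neighbours ¬uy₁
    non-adjacent (there (there (here refl)))         = ∈-non-neighbours ¬uy₂
    non-adjacent (there (there (there (here refl)))) = ∈-non-neighbours ¬uy

module AllQueriesShort {n} (Q : SimpleGraph n) {T₀ T : SimpleGraph n}
  (13≤n : 13 ≤ n) (deg : ∀ x → n ∸ 3 ≤ degree Q x)
  (tree₀ : IsTree T₀) (tree : IsTree T) (to : AgreeOn Q T₀ T) (from : AgreeOn Q T T₀)
  (short : ∀ {u v k} → Adj Q u v → Dist T₀ u v k → k ≤ 3) where

  open MinDegree Q deg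
  module Q = Walks Q
  module T₀ = Tree tree₀
  module T = Tree tree
  open T₀ using (Path₄) renaming (reverse-path₄ to reverse)

  4+≰3 : ∀ {s} → ¬ 4 + s ≤ 3
  4+≰3 (s≤s (s≤s (s≤s ())))

  short-in-T : ∀ {u v k} → Adj Q u v → Dist T u v k → k ≤ 3
  short-in-T uv Duv = short uv (from uv Duv)

  queried-edge : ∀ {u v} → Adj Q u v → Adj T₀ u v → Adj T u v
  queried-edge uv uv₀ = T.dist-one⇒adj (to uv (T₀.dist-adj uv₀))

  module _ {a b c d e : Fin n} where

    a≢e : Path₄ a b c d e → a ≢ e
    a≢e P = T₀.dist-suc⇒≢ (T₀.path₄-dist P)

    a≢d : Path₄ a b c d e → a ≢ d
    a≢d P = T₀.dist-suc⇒≢ (T₀.path₄-dist₃ P)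

    ends-unqueried : Path₄ a b c d e → ¬ Adj Q a e
    ends-unqueried P ae = 4+≰3 (short ae (T₀.path₄-dist P))

    endpoint-adjacent : ∀ {y z} → Path₄ a b c d e → ¬ Adj Q a y →
                        a ≢ y → e ≢ y → a ≢ z → e ≢ z → y ≢ z → Adj Q a z
    endpoint-adjacent P ¬ay = adjacent-unless-two (ends-unqueried P) ¬ay (a≢e P)

    behind-a : ∀ {w s} → Path₄ a b c d e → Adj Q w e → Dist T₀ w a s → Dist T₀ w b (suc s) → ⊥
    behind-a P we Da Db = 4+≰3 (short we (T₀.extend-path₄ Da Db P))

  unqueried-eb⇒queried-ed : ∀ {a b c d e} → Path₄ a b c d e → ¬ Adj Q e b → Adj Q e d
  unqueried-eb⇒queried-ed P ¬eb = endpoint-adjacent (reverse P) ¬eb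
    (a≢d (reverse P)) (T₀.adj⇒≢ ab) (≢-sym (T₀.adj⇒≢ de)) (a≢d P) b≢d
    where open Path₄ P

  -- w sees a, b, e, x at the same distance, at most 3, in T and in T₀. If its T-geodesic to x
  -- enters x from a, then d_T(w,e) ≥ 4 or w is a T₀-neighbour of a other than b, so d_T₀(w,e) = 5.
  -- Otherwise d_T(w,b) = d_T(w,a) + 1 ≥ 3, and equality forces d_T₀(w,e) = 6.
  module Bypass {a b c d e x w} (P : Path₄ a b c d e) (ab : Adj Q a b)
    (ax : Adj T a x) (xe : Adj T x e) (b≢x : b ≢ x)
    (wa : Adj Q w a) (wb : Adj Q w b) (we : Adj Q w e) (wx : Adj Q w x) where

    through-a : ∀ {t} → Dist T w a t → Dist T w x (suc t) → ⊥
    through-a {zero}        Dwa _   = Q.adj⇒≢ wa (T.dist-zero⇒≡ Dwa)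
    through-a {suc zero}    Dwa _   =
      behind-a P we Dwa₀ Dwb₀
      where
      Dwa₀ = from wa Dwa
      Dwb₀ = T₀.extend T₀.dist-refl Dwa₀ (T₀.dist-one⇒adj Dwa₀) (Path₄.ab P) (≢-sym (Q.adj⇒≢ wb))
    through-a {suc (suc t)} Dwa Dwx = 4+≰3 (short-in-T we (T.extend Dwa Dwx ax xe (≢-sym (a≢e P))))

    beyond-a : ∀ t → Dist T w a (2 + t) → Dist T w b (3 + t) → ⊥
    beyond-a zero    Dwa Dwb = behind-a P we (from wa Dwa) (from wb Dwb)
    beyond-a (suc t) _   Dwb = 4+≰3 (short-in-T wb Dwb)

    through-other : ∀ {t p} → Dist T w p t → Dist T w x (suc t) → Adj T p x → a ≢ p → ⊥
    through-other {t} Dwp Dwx px a≢p =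
      beyond-a t Dwa (T.extend Dwx Dwa (T.adj-sym ax) (queried-edge ab (Path₄.ab P)) b≢x)
      where Dwa = T.extend Dwp Dwx px (T.adj-sym ax) a≢p

    absurd : ⊥
    absurd with T.dist w x
    ... | zero  , Dwx = Q.adj⇒≢ wx (T.dist-zero⇒≡ Dwx)
    ... | suc t , Dwx with T.dist-pred Dwx
    ... | p , Dwp , px with a ≟ p
    ... | yes refl = through-a Dwp Dwx
    ... | no a≢p   = through-other Dwp Dwx px a≢p

  queried-first-edge⇒midpoint : ∀ {a b c d e x} → Path₄ a b c d e → Adj Q a b →
                                Adj T a x → Adj T x e → x ≡ b
  queried-first-edge⇒midpoint {a} {b} {e = e} {x} P ab ax xe with x ≟ b
  ... | yes x≡b = x≡b
  ... | no x≢b with common-neighbour (a ∷ b ∷ e ∷ x ∷ []) 13≤n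
  ... | w , wa ∷ wb ∷ we ∷ wx ∷ [] = ⊥-elim (Bypass.absurd P ab ax xe (≢-sym x≢b) wa wb we wx)

  no-midpoint-unqueried : ∀ {a b c d e x} → Path₄ a b c d e → ¬ Adj Q a x →
                          Adj T a x → Adj T x e → ⊥
  no-midpoint-unqueried {b = b} {x = x} P ¬ax ax xe with x ≟ b
  ... | no x≢b = x≢b (queried-first-edge⇒midpoint P ab′ ax xe)
    where
    ab′ = endpoint-adjacent P ¬ax (T.adj⇒≢ ax) (≢-sym (T.adj⇒≢ xe))
            (T₀.adj⇒≢ (Path₄.ab P)) (a≢d (reverse P)) x≢b
  ... | yes refl =
    Path₄.b≢d P (queried-first-edge⇒midpoint (reverse P) ed (T.adj-sym xe) (T.adj-sym ax))
    where
    ed = unqueried-eb⇒queried-ed P λ eb →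
      contradiction (proj₂ (to eb (T₀.path₄-dist₃ (reverse P))) 1 (step (T.adj-sym xe) here))
                    λ { (s≤s ()) }

  no-midpoint : ∀ {a b c d e x} → Path₄ a b c d e → Adj T a x → Adj T x e → ⊥
  no-midpoint {a} {e = e} {x} P ax xe with Q.Adj? a x | Q.Adj? e x
  ... | no ¬ax | _      = no-midpoint-unqueried P ¬ax ax xe
  ... | yes _  | no ¬ex = no-midpoint-unqueried (reverse P) ¬ex (T.adj-sym xe) (T.adj-sym ax)
  ... | yes ax′ | yes ex′ =
    contradiction (T₀.dist-adj-≤ (T₀.path₄-dist P) (from ax′ (T.dist-adj ax)) ex₀)
                  λ { (s≤s (s≤s ())) }
    where
    ex₀ = T₀.dist-one⇒adj (from ex′ (T.dist-adj (T.adj-sym xe)))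

  dist-ends-via-b : ∀ {a b c d e} → Path₄ a b c d e → Adj Q a b → Adj Q b e → Dist T a e 4
  dist-ends-via-b P ab be with to be (T₀.dist-sym (T₀.path₄-dist₃ (reverse P)))
  ... | step by (step yz (step ze here)) , shortest = T.path₄-dist record
    { ab = queried-edge ab (Path₄.ab P) ; bc = by ; cd = yz ; de = ze
    ; a≢c = λ { refl → no-midpoint P yz ze }
    ; b≢d = λ { refl → contradiction (shortest 1 (step ze here)) λ { (s≤s ()) } }
    ; c≢e = λ { refl → contradiction (shortest 1 (step by here)) λ { (s≤s ()) } } }

  dist-ends-unqueried : ∀ {a b c d e} → Path₄ a b c d e → ¬ Adj Q a c → Dist T a e 4
  dist-ends-unqueried {b = b} {e = e} P ¬ac with Q.Adj? e b
  ... | yes eb = dist-ends-via-b P ab′ (Q.adj-sym eb)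
    where
    open Path₄ P
    ab′ = endpoint-adjacent P ¬ac a≢c (≢-sym c≢e)
            (T₀.adj⇒≢ ab) (a≢d (reverse P)) (≢-sym (T₀.adj⇒≢ bc))
  ... | no ¬eb =
    T.dist-sym (dist-ends-via-b (reverse P) (unqueried-eb⇒queried-ed P ¬eb) (Q.adj-sym ad′))
    where
    open Path₄ P
    ad′ = endpoint-adjacent P ¬ac a≢c (≢-sym c≢e) (a≢d P) (≢-sym (T₀.adj⇒≢ de)) (T₀.adj⇒≢ cd)

  dist-ends : ∀ {a b c d e} → Path₄ a b c d e → Dist T a e 4
  dist-ends {a} {c = c} {e = e} P with Q.Adj? a c | Q.Adj? e c
  ... | no ¬ac | _      = dist-ends-unqueried P ¬ac
  ... | yes _  | no ¬ec = T.dist-sym (dist-ends-unqueried (reverse P) ¬ec)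
  ... | yes ac | yes ec with to ac (T₀.path₄-dist₂ P) | to ec (T₀.path₄-dist₂ (reverse P))
  ... | step ax (step xc here) , _ | step ey (step yc here) , _ = T.path₄-dist record
    { ab = ax ; bc = xc ; cd = T.adj-sym yc ; de = T.adj-sym ey
    ; a≢c = Path₄.a≢c P
    ; b≢d = λ { refl → no-midpoint P ax (T.adj-sym ey) }
    ; c≢e = Path₄.c≢e P }

lemma2p13 : (n : ℕ) → 13 ≤ n → (Q H : SimpleGraph n) →
    (∀ x → n ∸ 3 ≤ degree Q x) → IsTree H →
    (T₀ : SimpleGraph n) → IsTree T₀ → Consistent Q H T₀ → DiamAtLeast T₀ 4 →
    ∃[ x ] ∃[ y ] ∃[ j ] (4 ≤ j ×
      ((T : SimpleGraph n) → IsTree T → Consistent Q H T → Dist T x y j))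
lemma2p13 n 13≤n Q H deg treeH T₀ tree₀ consistent₀ (p , _ , _ , Dpq , s≤s (s≤s (s≤s (s≤s _))))
  with long-query-or-all-short Q (proj₁ tree₀) 3
... | inj₁ (u , v , j , uv , Duv , 3<j) =
  u , v , j , 3<j , λ T _ consistent →
    consistent⇒agree Q (proj₁ treeH) consistent₀ consistent uv Duv
... | inj₂ short with _ , _ , _ , e , P ← Walks.geodesic⇒path₄ T₀ Dpq =
  p , e , 4 , ≤-refl , λ T tree consistent →
    AllQueriesShort.dist-ends Q 13≤n deg tree₀ tree
      (consistent⇒agree Q (proj₁ treeH) consistent₀ consistent)
      (consistent⇒agree Q (proj₁ treeH) consistent consistent₀) short P
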